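{- For all $k\ge1$ and $n,q\ge0$, $L_k^q(n)=\sum_{p\in D_k(n)}A_{k,p+q}$, and hence $D_k(L_k^q(n))=\{p+q: p\in D_k(n)\}$.
   Context: For $k\ge1$, $F_k:\mathbb{N}\to\mathbb{N}$ is defined by $F_k(0)=0$ and $F_k(n)=n-F_k^k(n-1)$ for $n\ge1$, where $F_k^j$ denotes the $j$-th iterate of $F_k$. $L_k:\mathbb{N}\to\mathbb{N}$ is the function $L_k(n)=n+F_k^{k-1}(n)$ (equivalently, $L_k(n)$ is the length of the image under the substitution $\tau_k: k\mapsto k1,\ i\mapsto i+1\ (1\le i<k)$ of the length-$n$ prefix of the fixed point of $\tau_k$), and $L_k^q$ is its $q$-th iterate. The sequence $(A_{k,p})_{p\ge0}$ is defined by $A_{k,p}=p+1$ for $0\le p<k$ and $A_{k,p}=A_{k,p-1}+A_{k,p-k}$ for $p\ge k$. For $n\ge0$, $D_k(n)$ denotes the unique finite set $D\subset\mathbb{N}$ whose elements are pairwise at distance at least $k$ and such that $\sum_{p\in D}A_{k,p}=n$. -}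

module Defs where

open import Data.Nat using (ℕ; zero; suc; _+_; _∸_; _≤_; _<ᵇ_)
open import Data.Bool using (if_then_else_)
open import Data.List using (List; []; _∷_; map)
open import Data.Nat.ListAction using (sum)
open import Data.List.Relation.Unary.Linked using (Linked)
open import Function using (_∘_)

iter : (ℕ → ℕ) → ℕ → ℕ → ℕ
iter f zero    x = x
iter f (suc j) x = f (iter f j x)

-- Fuel-indexed version of F_k (F_k(0)=0, F_k(n)=n - F_k^k(n-1)).
-- With fuel > n the value at n is the true F_k(n), since F_k(m) ≤ m.
Ffuel : ℕ → ℕ → ℕ → ℕ
Ffuel k zero    n       = 0
Ffuel k (suc f) zero    = 0
Ffuel k (suc f) (suc n) = suc n ∸ iter (Ffuel k f) k n

F : ℕ → ℕ → ℕ
F k n = Ffuel k (suc n) n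

L : ℕ → ℕ → ℕ
L k n = n + iter (F k) (k ∸ 1) n

Afuel : ℕ → ℕ → ℕ → ℕ
Afuel k zero    p = 0
Afuel k (suc f) p = if p <ᵇ k then suc p else Afuel k f (p ∸ 1) + Afuel k f (p ∸ k)

A : ℕ → ℕ → ℕ
A k p = Afuel k (suc p) p

-- A finite set D ⊂ ℕ with pairwise distances ≥ k, represented as the list of
-- its elements in increasing order with consecutive gaps ≥ k.
Spread : ℕ → List ℕ → Set
Spread k = Linked (λ a b → a + k ≤ b)

IsD : ℕ → ℕ → List ℕ → Set
IsD k n D = Spread k D × (sum (map (A k) D) ≡ n)
  where
  open import Data.Product using (_×_)
  open import Relation.Binary.PropositionalEquality using (_≡_)

-- Write n = Σ_{p∈D} A_{k,p} with D k-spread. By strong induction on n, F_k acts on such a sum by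
-- lowering every position by one (truncating at 0). In the induction step n − 1 is represented by
-- borrowing from the least position of D, and with this representation the defining relation
-- n = F_k(n) + F_k^k(n − 1) becomes the recurrence of A position by position. Hence F_k^{k−1}
-- lowers positions by k − 1, so L_k(n) = Σ_{p∈D} (A_{k,p} + A_{k,p−k+1}) = Σ_{p∈D} A_{k,p+1},
-- and iterating gives the claim.
module Submission where

open import Defs
open import Data.Bool using (true; false; T)
open import Data.List using (List; []; _∷_; map)
open import Data.List.Properties using (map-∘; map-cong; map-id)
open import Data.List.Relation.Unary.Linked using ([]; [-]; _∷_)
open import Data.Nat using (ℕ; zero; suc; _+_; _∸_; _≤_; _<_; _≥_; _≤′_; ≤′-refl; ≤′-step; z≤n; s≤s; _<ᵇ_; _≤?_)
open import Data.Nat.Induction using (<-wellFounded)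
open import Data.Nat.ListAction using (sum)
open import Data.Nat.Properties
open import Algebra.Properties.CommutativeSemigroup +-commutativeSemigroup using (interchange; x∙yz≈yx∙z; xy∙z≈xz∙y)
open import Data.Product using (Σ-syntax; _×_; _,_)
open import Data.Unit using (tt)
open import Induction.WellFounded using (Acc; acc)
open import Relation.Nullary using (yes; no)
open import Relation.Binary.PropositionalEquality
  using (_≡_; refl; sym; trans; cong; cong₂; subst; module ≡-Reasoning)
open ≡-Reasoning

iter-≤ : ∀ {h} → (∀ x → h x ≤ x) → ∀ j n → iter h j n ≤ n
iter-≤ h≤ zero    n = ≤-refl
iter-≤ h≤ (suc j) n = ≤-trans (h≤ _) (iter-≤ h≤ j n)

iter-cong-≤ : ∀ {h h′} n → (∀ x → h x ≤ x) → (∀ x → x ≤ n → h x ≡ h′ x) →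
              ∀ j → iter h j n ≡ iter h′ j n
iter-cong-≤             n h≤ h≡h′ zero    = refl
iter-cong-≤ {h′ = h′} n h≤ h≡h′ (suc j) =
  trans (h≡h′ _ (iter-≤ h≤ j n)) (cong h′ (iter-cong-≤ n h≤ h≡h′ j))

Ffuel-≤ : ∀ k f n → Ffuel k f n ≤ n
Ffuel-≤ k zero    n       = z≤n
Ffuel-≤ k (suc f) zero    = z≤n
Ffuel-≤ k (suc f) (suc n) = m∸n≤m (suc n) (iter (Ffuel k f) k n)

Ffuel-stable : ∀ k f g n → n < f → n < g → Ffuel k f n ≡ Ffuel k g n
Ffuel-stable k (suc f) (suc g) zero    _         _         = refl
Ffuel-stable k (suc f) (suc g) (suc n) (s≤s n<f) (s≤s n<g) =
  cong (suc n ∸_) (iter-cong-≤ n (Ffuel-≤ k f)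
    (λ x x≤n → Ffuel-stable k f g x (≤-<-trans x≤n n<f) (≤-<-trans x≤n n<g)) k)

F-suc : ∀ k n → F k (suc n) ≡ suc n ∸ iter (F k) k n
F-suc k n = cong (suc n ∸_) (iter-cong-≤ n (Ffuel-≤ k (suc n))
  (λ x x≤n → Ffuel-stable k (suc n) (suc x) x (s≤s x≤n) ≤-refl) k)

module Numeration (k′ : ℕ) where

  k : ℕ
  k = suc k′

  Afuel-stable : ∀ f g p → p < f → p < g → Afuel k f p ≡ Afuel k g p
  Afuel-stable (suc f) (suc g) zero    _         _         = refl
  Afuel-stable (suc f) (suc g) (suc p) (s≤s p<f) (s≤s p<g) with suc p <ᵇ k
  ... | true  = refl
  ... | false = cong₂ _+_ (Afuel-stable f g p p<f p<g)
                          (Afuel-stable f g (p ∸ k′) (≤-<-trans (m∸n≤m p k′) p<f)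
                                                     (≤-<-trans (m∸n≤m p k′) p<g))

  A-small : ∀ {p} → p < k → A k p ≡ suc p
  A-small {p} p<k with p <ᵇ k | <⇒<ᵇ p<k
  ... | true | _ = refl

  A-suc : ∀ p → A k (suc p) ≡ A k p + A k (suc p ∸ k)
  A-suc p with suc p <ᵇ k in eq
  ... | false =
    cong (A k p +_) (Afuel-stable (suc p) (suc (p ∸ k′)) (p ∸ k′) (s≤s (m∸n≤m p k′)) ≤-refl)
  ... | true  = begin
    suc (suc p)              ≡⟨ +-comm 1 (suc p) ⟩
    suc p + 1                ≡⟨ cong₂ _+_ (sym (A-small (<-trans (n<1+n p) sp<k)))
                                          (cong (A k) (sym (m≤n⇒m∸n≡0 (<⇒≤ sp<k)))) ⟩
    A k p + A k (suc p ∸ k)  ∎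
    where
    sp<k : suc p < k
    sp<k = <ᵇ⇒< (suc p) k (subst T (sym eq) tt)

  A-suc-< : ∀ {p} → suc p ≤ k → A k (suc p) ≡ suc (A k p)
  A-suc-< {p} sp≤k = begin
    A k (suc p)              ≡⟨ A-suc p ⟩
    A k p + A k (suc p ∸ k)  ≡⟨ cong (λ i → A k p + A k i) (m≤n⇒m∸n≡0 sp≤k) ⟩
    A k p + 1                ≡⟨ +-comm (A k p) 1 ⟩
    suc (A k p)              ∎

  A-≤-suc : ∀ p → A k p ≤ A k (suc p)
  A-≤-suc p = ≤-trans (m≤m+n _ _) (≤-reflexive (sym (A-suc p)))

  A-mono-≤′ : ∀ {p p′} → p ≤′ p′ → A k p ≤ A k p′
  A-mono-≤′ ≤′-refl         = ≤-refl
  A-mono-≤′ (≤′-step p≤′p′) = ≤-trans (A-mono-≤′ p≤′p′) (A-≤-suc _)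

  value : List ℕ → ℕ
  value l = sum (map (A k) l)

  lower : ℕ → List ℕ → List ℕ
  lower i = map (_∸ i)

  lower-lower : ∀ i l → lower 1 (lower i l) ≡ lower (suc i) l
  lower-lower i l =
    trans (sym (map-∘ l)) (map-cong (λ p → trans (∸-+-assoc p i 1) (cong (p ∸_) (+-comm i 1))) l)

  value-lower-≤ : ∀ i l → value (lower i l) ≤ value l
  value-lower-≤ i []      = ≤-refl
  value-lower-≤ i (p ∷ l) = +-mono-≤ (A-mono-≤′ (≤⇒≤′ (m∸n≤m p i))) (value-lower-≤ i l)

  value-map-suc : ∀ l → value l + value (lower k′ l) ≡ value (map suc l)
  value-map-suc []      = refl
  value-map-suc (p ∷ l) = trans (interchange (A k p) (value l) (A k (p ∸ k′)) (value (lower k′ l)))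
                                (cong₂ _+_ (sym (A-suc p)) (value-map-suc l))

  data SpreadFrom : ℕ → List ℕ → Set where
    []  : ∀ {b} → SpreadFrom b []
    _∷_ : ∀ {b p l} → b ≤ p → SpreadFrom (p + k) l → SpreadFrom b (p ∷ l)

  spreadFrom-weaken : ∀ {b b′ l} → b′ ≤ b → SpreadFrom b l → SpreadFrom b′ l
  spreadFrom-weaken b′≤b []        = []
  spreadFrom-weaken b′≤b (b≤p ∷ s) = ≤-trans b′≤b b≤p ∷ s

  spreadFrom-lower : ∀ {b l} i → i ≤ b → SpreadFrom b l → SpreadFrom (b ∸ i) (lower i l)
  spreadFrom-lower              i i≤b []        = []
  spreadFrom-lower {l = p ∷ l} i i≤b (b≤p ∷ s) =
    ∸-monoˡ-≤ i b≤p ∷ subst (λ b → SpreadFrom b (lower i l)) (+-∸-comm k i≤p)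
                             (spreadFrom-lower i (≤-trans i≤p (m≤m+n p k)) s)
    where
    i≤p : i ≤ p
    i≤p = ≤-trans i≤b b≤p

  spreadFrom-raise : ∀ {b l} q → SpreadFrom b l → SpreadFrom (b + q) (map (_+ q) l)
  spreadFrom-raise              q []        = []
  spreadFrom-raise {l = p ∷ l} q (b≤p ∷ s) =
    +-monoˡ-≤ q b≤p ∷ subst (λ b → SpreadFrom b (map (_+ q) l)) (xy∙z≈xz∙y p k q)
                             (spreadFrom-raise q s)

  spread⇒spreadFrom : ∀ {l} → Spread k l → SpreadFrom 0 l
  spread⇒spreadFrom []        = []
  spread⇒spreadFrom {p ∷ _} s = from z≤n s
    where
    from : ∀ {b p l} → b ≤ p → Spread k (p ∷ l) → SpreadFrom b (p ∷ l)
    from b≤p [-]        = b≤p ∷ []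
    from b≤p (p+k≤ ∷ s) = b≤p ∷ from p+k≤ s

  spreadFrom⇒spread : ∀ {b l} → SpreadFrom b l → Spread k l
  spreadFrom⇒spread []                 = []
  spreadFrom⇒spread (_ ∷ [])           = [-]
  spreadFrom⇒spread (_ ∷ s@(p+k≤ ∷ _)) = p+k≤ ∷ spreadFrom⇒spread s

  -- Lowering a spread list by i < k can bring its least position down to 0 at distance less than k
  -- from the next one; F_k still acts on such lists by lowering all positions by one.
  data Admissible : List ℕ → Set where
    spread  : ∀ {l} → SpreadFrom 0 l → Admissible l
    collide : ∀ {l} → SpreadFrom 1 l → Admissible (0 ∷ l)

  lower-admissible : ∀ {l} i → i < k → SpreadFrom 0 l → Admissible (lower i l)
  lower-admissible         i i<k []      = spread []
  lower-admissible {p ∷ l} i i<k (_ ∷ s) with i ≤? p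
  ... | yes i≤p = spread (spreadFrom-weaken z≤n (spreadFrom-lower i ≤-refl (i≤p ∷ s)))
  ... | no  i≰p rewrite m≤n⇒m∸n≡0 (<⇒≤ (≰⇒> i≰p)) =
    collide (spreadFrom-weaken (m<n⇒0<n∸m i<p+k) (spreadFrom-lower i (<⇒≤ i<p+k) s))
    where
    i<p+k : i < p + k
    i<p+k = <-≤-trans i<k (m≤n+m k p)

  admissible-tail : ∀ {l} → Admissible (0 ∷ l) → SpreadFrom 1 l
  admissible-tail (spread (_ ∷ s)) = spreadFrom-weaken (s≤s z≤n) s
  admissible-tail (collide s)      = s

  value-split : ∀ {l} → SpreadFrom 1 l → value l ≡ value (lower 1 l) + value (lower k l)
  value-split              []      = refl
  value-split {suc p ∷ l} (_ ∷ s) = begin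
    A k (suc p) + value l
      ≡⟨ cong₂ _+_ (A-suc p) (value-split (spreadFrom-weaken (s≤s z≤n) s)) ⟩
    (A k p + A k (suc p ∸ k)) + (value (lower 1 l) + value (lower k l))
      ≡⟨ interchange (A k p) (A k (suc p ∸ k)) (value (lower 1 l)) _ ⟩
    (A k p + value (lower 1 l)) + (A k (suc p ∸ k) + value (lower k l))  ∎

  -- c is q − jk ∷ ⋯ ∷ q − k ∷ q ∷ l with q − jk < k, as A_{q+1} − 1 = A_{q−jk} + ⋯ + A_{q−k} + A_q.
  borrow : ∀ {q} → Acc _<_ q → ∀ {l} → SpreadFrom (q + k) l →
    Σ[ c ∈ List ℕ ] SpreadFrom 0 c
      × suc (value c) ≡ A k (suc q) + value l
      × value (lower k c) ≡ A k (suc q ∸ k) + value (lower k l)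
  borrow {q} (acc smaller) {l} s with k ≤? q
  ... | no  k≰q = q ∷ l , z≤n ∷ s , cong (_+ value l) (sym (A-suc-< sq≤k)) ,
                  cong (λ i → A k i + value (lower k l))
                       (trans (m≤n⇒m∸n≡0 (≤-trans (n≤1+n q) sq≤k)) (sym (m≤n⇒m∸n≡0 sq≤k)))
    where
    sq≤k : suc q ≤ k
    sq≤k = ≰⇒> k≰q
  ... | yes k≤q with borrow (smaller (∸-monoʳ-< (s≤s z≤n) k≤q)) (≤-reflexive (m∸n+n≡m k≤q) ∷ s)
  ...   | c , c-spread , c-value , c-lower = c , c-spread , c-value′ , c-lower′
    where
    q′ : ℕ
    q′ = q ∸ k
    sq∸k : suc q ∸ k ≡ suc q′
    sq∸k = +-∸-assoc 1 k≤q
    c-value′ : suc (value c) ≡ A k (suc q) + value l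
    c-value′ = begin
      suc (value c)                        ≡⟨ c-value ⟩
      A k (suc q′) + (A k q + value l)     ≡⟨ x∙yz≈yx∙z (A k (suc q′)) (A k q) (value l) ⟩
      (A k q + A k (suc q′)) + value l     ≡⟨ cong (λ i → (A k q + A k i) + value l) (sym sq∸k) ⟩
      (A k q + A k (suc q ∸ k)) + value l  ≡⟨ cong (_+ value l) (sym (A-suc q)) ⟩
      A k (suc q) + value l                ∎
    c-lower′ : value (lower k c) ≡ A k (suc q ∸ k) + value (lower k l)
    c-lower′ = begin
      value (lower k c)
        ≡⟨ c-lower ⟩
      A k (suc q′ ∸ k) + (A k q′ + value (lower k l))
        ≡⟨ x∙yz≈yx∙z (A k (suc q′ ∸ k)) (A k q′) (value (lower k l)) ⟩
      (A k q′ + A k (suc q′ ∸ k)) + value (lower k l)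
        ≡⟨ cong (_+ value (lower k l)) (sym (A-suc q′)) ⟩
      A k (suc q′) + value (lower k l)
        ≡⟨ cong (λ i → A k i + value (lower k l)) (sym sq∸k) ⟩
      A k (suc q ∸ k) + value (lower k l)  ∎

  -- The last component is the defining relation n = F_k(n) + F_k^k(n − 1) in terms of representations.
  predecessor : ∀ {p l} → Admissible (p ∷ l) →
    Σ[ l′ ∈ List ℕ ] SpreadFrom 0 l′
      × suc (value l′) ≡ value (p ∷ l)
      × value (p ∷ l) ≡ value (lower 1 (p ∷ l)) + value (lower k l′)
  predecessor {zero} {l} adm = l , spreadFrom-weaken z≤n tail , refl , cong suc (value-split tail)
    where
    tail : SpreadFrom 1 l
    tail = admissible-tail adm
  predecessor {suc q} {l} (spread (_ ∷ s))
    with borrow (<-wellFounded q) (spreadFrom-weaken (+-monoˡ-≤ k (n≤1+n q)) s)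
  ... | c , c-spread , c-value , c-lower = c , c-spread , c-value , split
    where
    split : A k (suc q) + value l ≡ (A k q + value (lower 1 l)) + value (lower k c)
    split = begin
      A k (suc q) + value l
        ≡⟨ cong₂ _+_ (A-suc q) (value-split (spreadFrom-weaken (s≤s z≤n) s)) ⟩
      (A k q + A k (suc q ∸ k)) + (value (lower 1 l) + value (lower k l))
        ≡⟨ interchange (A k q) (A k (suc q ∸ k)) (value (lower 1 l)) _ ⟩
      (A k q + value (lower 1 l)) + (A k (suc q ∸ k) + value (lower k l))
        ≡⟨ cong ((A k q + value (lower 1 l)) +_) (sym c-lower) ⟩
      (A k q + value (lower 1 l)) + value (lower k c)  ∎

  iter-F-value : ∀ {l} → SpreadFrom 0 l →
    (∀ l′ → Admissible l′ → value l′ ≤ value l → F k (value l′) ≡ value (lower 1 l′)) →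
    ∀ i → i ≤ k → iter (F k) i (value l) ≡ value (lower i l)
  iter-F-value {l} s F-value-below zero    _   = cong value (sym (map-id l))
  iter-F-value {l} s F-value-below (suc i) i<k = begin
    F k (iter (F k) i (value l))  ≡⟨ cong (F k) (iter-F-value s F-value-below i (<⇒≤ i<k)) ⟩
    F k (value (lower i l))       ≡⟨ F-value-below (lower i l) (lower-admissible i i<k s)
                                                     (value-lower-≤ i l) ⟩
    value (lower 1 (lower i l))   ≡⟨ cong value (lower-lower i l) ⟩
    value (lower (suc i) l)       ∎

  F-value-acc : ∀ l → Acc _<_ (value l) → Admissible l → F k (value l) ≡ value (lower 1 l)
  F-value-acc []      _             _   = refl
  F-value-acc (p ∷ l) (acc smaller) adm with predecessor adm
  ... | l′ , l′-spread , l′-value , split = begin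
    F k (value (p ∷ l))
      ≡⟨ cong (F k) (sym l′-value) ⟩
    F k (suc m)
      ≡⟨ F-suc k m ⟩
    suc m ∸ iter (F k) k m
      ≡⟨ cong₂ _∸_ l′-value (iter-F-value l′-spread F-value-below k ≤-refl) ⟩
    value (p ∷ l) ∸ value (lower k l′)
      ≡⟨ cong (_∸ value (lower k l′)) split ⟩
    value (lower 1 (p ∷ l)) + value (lower k l′) ∸ value (lower k l′)
      ≡⟨ m+n∸n≡m (value (lower 1 (p ∷ l))) (value (lower k l′)) ⟩
    value (lower 1 (p ∷ l))  ∎
    where
    m : ℕ
    m = value l′
    F-value-below : ∀ l″ → Admissible l″ → value l″ ≤ m → F k (value l″) ≡ value (lower 1 l″)
    F-value-below l″ adm″ l″≤m = F-value-acc l″ (smaller (≤-<-trans l″≤m (≤-reflexive l′-value))) adm″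

  F-value : ∀ l → Admissible l → F k (value l) ≡ value (lower 1 l)
  F-value l = F-value-acc l (<-wellFounded (value l))

  L-value : ∀ {l} → SpreadFrom 0 l → L k (value l) ≡ value (map suc l)
  L-value {l} s = begin
    value l + iter (F k) k′ (value l)
      ≡⟨ cong (value l +_) (iter-F-value s (λ l′ adm _ → F-value l′ adm) k′ (n≤1+n k′)) ⟩
    value l + value (lower k′ l)
      ≡⟨ value-map-suc l ⟩
    value (map suc l)  ∎

  iter-L-value : ∀ {l} → SpreadFrom 0 l → ∀ q → iter (L k) q (value l) ≡ value (map (_+ q) l)
  iter-L-value {l} s zero    = cong value (sym (trans (map-cong +-identityʳ l) (map-id l)))
  iter-L-value {l} s (suc q) = begin
    L k (iter (L k) q (value l))    ≡⟨ cong (L k) (iter-L-value s q) ⟩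
    L k (value (map (_+ q) l))      ≡⟨ L-value (spreadFrom-weaken z≤n (spreadFrom-raise q s)) ⟩
    value (map suc (map (_+ q) l))  ≡⟨ cong value (trans (sym (map-∘ l))
                                                         (map-cong (λ p → sym (+-suc p q)) l)) ⟩
    value (map (_+ suc q) l)        ∎

proposition4p12 : ∀ (k n q : ℕ) → k ≥ 1 → (D : List ℕ) → IsD k n D →
    (iter (L k) q n ≡ sum (map (λ p → A k (p + q)) D))
    × IsD k (iter (L k) q n) (map (λ p → p + q) D)
proposition4p12 (suc k′) _ q _ D (D-spread , refl) =
  trans iterate (cong sum (sym (map-∘ D))) ,
  spreadFrom⇒spread (spreadFrom-raise q D-spreadFrom) ,
  sym iterate
  where
  open Numeration k′
  D-spreadFrom : SpreadFrom 0 D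
  D-spreadFrom = spread⇒spreadFrom D-spread
  iterate : iter (L k) q (value D) ≡ value (map (_+ q) D)
  iterate = iter-L-value D-spreadFrom q
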